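{- There exist an LPTS $L$ and a reactive LPTS $R$ such that $L\not\preceq R$ and there is no reactive LPTS $C$ with $C\preceq L$ and $C\not\preceq R$.
   Context: For a set $S$, $\mathrm{Dist}(S)$ is the set of discrete probability distributions on $S$ (rational probabilities). An LPTS is a tuple $\langle S,s^0,\alpha,\tau\rangle$ with finite state set $S$, start state $s^0$, finite action set $\alpha$ and finite transition relation $\tau\subseteq S\times\alpha\times\mathrm{Dist}(S)$; write $s\xrightarrow{a}\mu$. An LPTS is reactive if each state has at most one transition on each action. For LPTSes $L_i=\langle S_i,s^0_i,\alpha_i,\tau_i\rangle$ and $R'\subseteq S_1\times S_2$, $\mu_1\sqsubseteq_{R'}\mu_2$ iff there is $w:S_1\times S_2\to\mathbb{Q}\cap[0,1]$ with $\mu_1(s_1)=\sum_{s_2}w(s_1,s_2)$, $\mu_2(s_2)=\sum_{s_1}w(s_1,s_2)$, and $w(s_1,s_2)>0\Rightarrow s_1R's_2$. $R'$ is a strong simulation iff whenever $s_1R's_2$ and $s_1\xrightarrow{a}\mu_1$ there is $s_2\xrightarrow{a}\mu_2$ with $\mu_1\sqsubseteq_{R'}\mu_2$; $L_1\preceq L_2$ iff some strong simulation contains $(s^0_1,s^0_2)$. -}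

module Defs where

open import Level using (0ℓ)
open import Data.Nat using (ℕ; zero; suc)
open import Data.Fin using (Fin; zero; suc)
open import Data.Rational using (ℚ; 0ℚ; 1ℚ; _+_; _≤_; _<_)
open import Data.List using (List)
open import Data.List.Membership.Propositional using (_∈_)
open import Data.Product using (Σ; ∃; ∃-syntax; _×_; _,_)
open import Relation.Binary.PropositionalEquality using (_≡_)
open import Relation.Nullary using (¬_)

Action : Set
Action = ℕ

sumFin : ∀ {n} → (Fin n → ℚ) → ℚ
sumFin {zero}  f = 0ℚ
sumFin {suc n} f = f zero + sumFin (λ i → f (suc i))

record Dist (n : ℕ) : Set where
  field
    prob   : Fin n → ℚ
    nonneg : ∀ i → 0ℚ ≤ prob i
    total  : sumFin prob ≡ 1ℚ
open Dist public

record Trans (n : ℕ) : Set where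
  constructor ⟨_,_,_⟩
  field
    src  : Fin n
    act  : Action
    dist : Dist n
open Trans public

record LPTS : Set where
  field
    states   : ℕ
    start    : Fin states
    alphabet : List Action
    trans    : List (Trans states)
    trans-in-alphabet : ∀ t → t ∈ trans → act t ∈ alphabet
open LPTS public

State : LPTS → Set
State L = Fin (states L)

_⊢_─[_]→_ : (L : LPTS) → State L → Action → Dist (states L) → Set
L ⊢ s ─[ a ]→ μ = ∃[ t ] (t ∈ trans L × src t ≡ s × act t ≡ a × dist t ≡ μ)

-- Reactive: at most one transition per state and action
-- (distributions being equal as functions, i.e. pointwise).
Reactive : LPTS → Set
Reactive L = ∀ s a μ ν → L ⊢ s ─[ a ]→ μ → L ⊢ s ─[ a ]→ ν →
             ∀ x → prob μ x ≡ prob ν x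

Lift : ∀ {n₁ n₂} → (Fin n₁ → Fin n₂ → Set) → Dist n₁ → Dist n₂ → Set
Lift {n₁} {n₂} R' μ₁ μ₂ =
  Σ (Fin n₁ → Fin n₂ → ℚ) λ w →
    (∀ s₁ s₂ → 0ℚ ≤ w s₁ s₂ × w s₁ s₂ ≤ 1ℚ)
  × (∀ s₁ → prob μ₁ s₁ ≡ sumFin (λ s₂ → w s₁ s₂))
  × (∀ s₂ → prob μ₂ s₂ ≡ sumFin (λ s₁ → w s₁ s₂))
  × (∀ s₁ s₂ → 0ℚ < w s₁ s₂ → R' s₁ s₂)

StrongSimulation : (L₁ L₂ : LPTS) → (State L₁ → State L₂ → Set) → Set
StrongSimulation L₁ L₂ R' =
  ∀ s₁ s₂ → R' s₁ s₂ → ∀ a μ₁ → L₁ ⊢ s₁ ─[ a ]→ μ₁ →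
    ∃[ μ₂ ] (L₂ ⊢ s₂ ─[ a ]→ μ₂ × Lift R' μ₁ μ₂)

_≼_ : LPTS → LPTS → Set₁
L₁ ≼ L₂ = Σ (State L₁ → State L₂ → Set) λ R' →
            StrongSimulation L₁ L₂ R' × R' (start L₁) (start L₂)

-- L tosses a fair coin between a dead state and a choice state, which on action 0
-- commits nondeterministically to a 2-loop or to a 3-loop; R tosses the coin directly
-- between the two loops (both of which also accept 0). L ⋠ R because the choice state
-- would have to be matched by one loop and then fail to follow into the other.
-- Conversely, in a reactive C a state simulated by the choice state has at most one
-- 0-move, so it is already committed to one of the loops, and relating C to R through
-- these commitments is a simulation. The arithmetic sits in the coin toss: the committed
-- mass sent to the left loop is anything up to ½, and the mass simulated by the dead
-- state (which is dead itself, hence related to both loops) is split to rebalance both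
-- sides to ½.

module Submission where

open import Defs
open import Algebra.Bundles using (CommutativeRing)
import Algebra.Properties.Group as GroupProperties
import Algebra.Properties.Semiring.Sum as SemiringSum
open import Data.Fin using (Fin; zero; suc)
import Data.Fin.Properties as Fin
open import Data.List using (List; []; _∷_; map)
open import Data.List.Membership.Propositional using (find; lose)
open import Data.List.Membership.Propositional.Properties using (∈-map⁺)
open import Data.List.Relation.Unary.Any using (here; there; any?)
open import Data.Nat using (zero; suc)
import Data.Nat as ℕ
open import Data.Product using (Σ; ∃-syntax; _×_; _,_; proj₁; proj₂)
open import Data.Rational using (ℚ; 0ℚ; 1ℚ; ½; _+_; _*_; _-_; -_; _≤_; _<_; nonNegative)
import Data.Rational.Properties as ℚ
open import Data.Rational.Solver using (module +-*-Solver)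
open import Data.Sum using (_⊎_; inj₁; inj₂; [_,_]′; map₂)
open import Function using (const)
open import Relation.Binary.PropositionalEquality
  using (_≡_; refl; sym; cong; cong₂; subst; _≗_; module ≡-Reasoning)
  renaming (trans to ≡-trans)
open import Relation.Nullary using (¬_; Dec; yes; no; contradiction)
open import Relation.Nullary.Decidable using (_×-dec_)

open ≡-Reasoning

0≮0 : ¬ (0ℚ < 0ℚ)
0≮0 = ℚ.<-irrefl refl

p≤p+q : ∀ {p q} → 0ℚ ≤ q → p ≤ p + q
p≤p+q {p} {q} 0≤q = subst (_≤ p + q) (ℚ.+-identityʳ p) (ℚ.+-monoʳ-≤ p 0≤q)

p≤q+p : ∀ {p q} → 0ℚ ≤ q → p ≤ q + p
p≤q+p {p} {q} 0≤q = subst (p ≤_) (ℚ.+-comm p q) (p≤p+q 0≤q)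

0≤q-p : ∀ {p q} → p ≤ q → 0ℚ ≤ q - p
0≤q-p {p} {q} p≤q = subst (_≤ q - p) (ℚ.+-inverseʳ p) (ℚ.+-monoˡ-≤ (- p) p≤q)

0≤p*q : ∀ {p q} → 0ℚ ≤ p → 0ℚ ≤ q → 0ℚ ≤ p * q
0≤p*q {p} {q} 0≤p 0≤q = subst (_≤ p * q) (ℚ.*-zeroʳ p) (ℚ.*-monoˡ-≤-nonNeg p {{nonNegative 0≤p}} 0≤q)

0<p+q⇒ : ∀ {p q} → 0ℚ < p + q → 0ℚ < p ⊎ 0ℚ < q
0<p+q⇒ {p} {q} 0<p+q with 0ℚ ℚ.<? p | 0ℚ ℚ.<? q
... | yes 0<p | _       = inj₁ 0<p
... | no _    | yes 0<q = inj₂ 0<q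
... | no 0≮p  | no 0≮q  =
  contradiction (ℚ.<-≤-trans 0<p+q (ℚ.+-mono-≤ (ℚ.≮⇒≥ 0≮p) (ℚ.≮⇒≥ 0≮q))) 0≮0

0<p*q⇒0<q : ∀ {p q} → 0ℚ ≤ p → 0ℚ < p * q → 0ℚ < q
0<p*q⇒0<q {p} {q} 0≤p 0<pq with 0ℚ ℚ.<? q
... | yes 0<q = 0<q
... | no 0≮q  = contradiction (ℚ.<-≤-trans 0<pq pq≤0) 0≮0
  where
  pq≤0 : p * q ≤ 0ℚ
  pq≤0 = subst (p * q ≤_) (ℚ.*-zeroʳ p)
           (ℚ.*-monoˡ-≤-nonNeg p {{nonNegative 0≤p}} (ℚ.≮⇒≥ 0≮q))

module ∑ = SemiringSum (CommutativeRing.semiring ℚ.+-*-commutativeRing)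

sumFin≡sum : ∀ {n} (f : Fin n → ℚ) → sumFin f ≡ ∑.sum f
sumFin≡sum {zero}  f = refl
sumFin≡sum {suc n} f = cong (f zero +_) (sumFin≡sum (λ i → f (suc i)))

sumFin-cong : ∀ {n} {f g : Fin n → ℚ} → f ≗ g → sumFin f ≡ sumFin g
sumFin-cong {f = f} {g} f≗g = begin
  sumFin f  ≡⟨ sumFin≡sum f ⟩
  ∑.sum f   ≡⟨ ∑.sum-cong-≗ f≗g ⟩
  ∑.sum g   ≡⟨ sumFin≡sum g ⟨
  sumFin g  ∎

sumFin-zero : ∀ n → sumFin {n} (λ _ → 0ℚ) ≡ 0ℚ
sumFin-zero n = begin
  sumFin {n} (λ _ → 0ℚ) ≡⟨ sumFin≡sum {n} _ ⟩
  ∑.sum {n} (λ _ → 0ℚ)  ≡⟨ ∑.sum-replicate-zero n ⟩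
  0ℚ                     ∎

sumFin-+ : ∀ {n} (f g : Fin n → ℚ) → sumFin (λ i → f i + g i) ≡ sumFin f + sumFin g
sumFin-+ f g = begin
  sumFin (λ i → f i + g i) ≡⟨ sumFin≡sum (λ i → f i + g i) ⟩
  ∑.sum (λ i → f i + g i)  ≡⟨ ∑.∑-distrib-+ f g ⟩
  ∑.sum f + ∑.sum g        ≡⟨ cong₂ _+_ (sumFin≡sum f) (sumFin≡sum g) ⟨
  sumFin f + sumFin g      ∎

sumFin-*ˡ : ∀ {n} k (f : Fin n → ℚ) → sumFin (λ i → k * f i) ≡ k * sumFin f
sumFin-*ˡ k f = begin
  sumFin (λ i → k * f i) ≡⟨ sumFin≡sum (λ i → k * f i) ⟩
  ∑.sum (λ i → k * f i)  ≡⟨ ∑.*-distribˡ-sum k f ⟨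
  k * ∑.sum f            ≡⟨ cong (k *_) (sumFin≡sum f) ⟨
  k * sumFin f           ∎

sumFin-*ʳ : ∀ {n} k (f : Fin n → ℚ) → sumFin (λ i → f i * k) ≡ sumFin f * k
sumFin-*ʳ k f = begin
  sumFin (λ i → f i * k) ≡⟨ sumFin-cong (λ i → ℚ.*-comm (f i) k) ⟩
  sumFin (λ i → k * f i) ≡⟨ sumFin-*ˡ k f ⟩
  k * sumFin f           ≡⟨ ℚ.*-comm k (sumFin f) ⟩
  sumFin f * k           ∎

sumFin-mono : ∀ {n} {f g : Fin n → ℚ} → (∀ i → f i ≤ g i) → sumFin f ≤ sumFin g
sumFin-mono {zero}  f≤g = ℚ.≤-refl
sumFin-mono {suc n} f≤g = ℚ.+-mono-≤ (f≤g zero) (sumFin-mono (λ i → f≤g (suc i)))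

sumFin-nonneg : ∀ {n} {f : Fin n → ℚ} → (∀ i → 0ℚ ≤ f i) → 0ℚ ≤ sumFin f
sumFin-nonneg {n} {f} 0≤f = subst (_≤ sumFin f) (sumFin-zero n) (sumFin-mono 0≤f)

≤-sumFin : ∀ {n} {f : Fin n → ℚ} → (∀ i → 0ℚ ≤ f i) → ∀ i → f i ≤ sumFin f
≤-sumFin 0≤f zero    = p≤p+q (sumFin-nonneg (λ i → 0≤f (suc i)))
≤-sumFin 0≤f (suc i) = ℚ.≤-trans (≤-sumFin (λ i → 0≤f (suc i)) i) (p≤q+p (0≤f zero))

sumFin≡0⇒≡0 : ∀ {n} {f : Fin n → ℚ} → (∀ i → 0ℚ ≤ f i) → sumFin f ≡ 0ℚ → ∀ i → f i ≡ 0ℚ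
sumFin≡0⇒≡0 0≤f ∑f≡0 i = ℚ.≤-antisym (subst (_ ≤_) ∑f≡0 (≤-sumFin 0≤f i)) (0≤f i)

0<sumFin⇒ : ∀ {n} {f : Fin n → ℚ} → 0ℚ < sumFin f → ∃[ i ] 0ℚ < f i
0<sumFin⇒ {zero}  0<0 = contradiction 0<0 0≮0
0<sumFin⇒ {suc n} 0<∑ with 0<p+q⇒ 0<∑
... | inj₁ 0<f₀ = zero , 0<f₀
... | inj₂ 0<∑′ = let i , 0<fᵢ = 0<sumFin⇒ 0<∑′ in suc i , 0<fᵢ

prob≤1 : ∀ {n} (μ : Dist n) i → prob μ i ≤ 1ℚ
prob≤1 μ i = subst (prob μ i ≤_) (total μ) (≤-sumFin (nonneg μ) i)

spike : ∀ {n} → Fin n → ℚ → Fin n → ℚ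
spike zero    a zero    = a
spike zero    a (suc j) = 0ℚ
spike (suc i) a zero    = 0ℚ
spike (suc i) a (suc j) = spike i a j

spike-nonneg : ∀ {n} (i : Fin n) {a} → 0ℚ ≤ a → ∀ j → 0ℚ ≤ spike i a j
spike-nonneg zero    0≤a zero    = 0≤a
spike-nonneg zero    0≤a (suc j) = ℚ.≤-refl
spike-nonneg (suc i) 0≤a zero    = ℚ.≤-refl
spike-nonneg (suc i) 0≤a (suc j) = spike-nonneg i 0≤a j

spike-support : ∀ {n} {i j : Fin n} {a} → 0ℚ < spike i a j → i ≡ j
spike-support {i = zero}  {zero}  _   = refl
spike-support {i = zero}  {suc j} 0<0 = contradiction 0<0 0≮0
spike-support {i = suc i} {zero}  0<0 = contradiction 0<0 0≮0
spike-support {i = suc i} {suc j} 0<a = cong suc (spike-support 0<a)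

sumFin-spike : ∀ {n} (i : Fin n) a → sumFin (spike i a) ≡ a
sumFin-spike {suc n} zero    a = ≡-trans (cong (a +_) (sumFin-zero n)) (ℚ.+-identityʳ a)
sumFin-spike {suc n} (suc i) a = ≡-trans (cong (0ℚ +_) (sumFin-spike i a)) (ℚ.+-identityˡ a)

δ : ∀ {n} → Fin n → Dist n
δ i = record
  { prob   = spike i 1ℚ
  ; nonneg = spike-nonneg i (ℚ.nonNegative⁻¹ 1ℚ)
  ; total  = sumFin-spike i 1ℚ
  }

coin : ∀ {n} → Fin n → Fin n → Dist n
coin i j = record
  { prob   = λ k → spike i ½ k + spike j ½ k
  ; nonneg = λ k → ℚ.+-mono-≤ (spike-nonneg i 0≤½ k) (spike-nonneg j 0≤½ k)
  ; total  = ≡-trans (sumFin-+ (spike i ½) (spike j ½))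
                     (cong₂ _+_ (sumFin-spike i ½) (sumFin-spike j ½))
  }
  where
  0≤½ : 0ℚ ≤ ½
  0≤½ = ℚ.nonNegative⁻¹ ½

SupportRelated : ∀ {n₁ n₂} → (Fin n₁ → Fin n₂ → Set) → Dist n₁ → Fin n₂ → Set
SupportRelated R μ r = ∀ s → 0ℚ < prob μ s → R s r

module _ {n₁ n₂} {R : Fin n₁ → Fin n₂ → Set} where

  Lift-fromCoupling : ∀ {μ₁ μ₂} (w : Fin n₁ → Fin n₂ → ℚ) →
    (∀ s₁ s₂ → 0ℚ ≤ w s₁ s₂) →
    (∀ s₁ → prob μ₁ s₁ ≡ sumFin (w s₁)) →
    (∀ s₂ → prob μ₂ s₂ ≡ sumFin (λ s₁ → w s₁ s₂)) →
    (∀ s₁ s₂ → 0ℚ < w s₁ s₂ → R s₁ s₂) →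
    Lift R μ₁ μ₂
  Lift-fromCoupling {μ₁} w 0≤w row col related = w , bounds , row , col , related
    where
    bounds : ∀ s₁ s₂ → 0ℚ ≤ w s₁ s₂ × w s₁ s₂ ≤ 1ℚ
    bounds s₁ s₂ = 0≤w s₁ s₂ , ℚ.≤-trans (subst (w s₁ s₂ ≤_) (sym (row s₁)) (≤-sumFin (0≤w s₁) s₂))
                                         (prob≤1 μ₁ s₁)

  Lift-support : ∀ {μ ν} → Lift R μ ν → ∀ s → 0ℚ < prob μ s → ∃[ r ] (R s r × 0ℚ < prob ν r)
  Lift-support (w , bounds , row , col , related) s 0<μs
    with 0<sumFin⇒ {f = w s} (subst (0ℚ <_) (row s) 0<μs)
  ... | r , 0<w = r , related s r 0<w , ℚ.<-≤-trans 0<w (subst (w s r ≤_) (sym (col r)) w≤∑)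
    where
    w≤∑ : w s r ≤ sumFin (λ s′ → w s′ r)
    w≤∑ = ≤-sumFin (λ s′ → proj₁ (bounds s′ r)) s

  Lift-product : ∀ {μ ν} → (∀ s r → 0ℚ < prob μ s → 0ℚ < prob ν r → R s r) → Lift R μ ν
  Lift-product {μ} {ν} related = Lift-fromCoupling {μ} {ν} (λ s r → prob μ s * prob ν r)
    (λ s r → 0≤p*q (nonneg μ s) (nonneg ν r)) row col support
    where
    row : ∀ s → prob μ s ≡ sumFin (λ r → prob μ s * prob ν r)
    row s = sym (begin
      sumFin (λ r → prob μ s * prob ν r) ≡⟨ sumFin-*ˡ (prob μ s) (prob ν) ⟩
      prob μ s * sumFin (prob ν)         ≡⟨ cong (prob μ s *_) (total ν) ⟩
      prob μ s * 1ℚ                      ≡⟨ ℚ.*-identityʳ (prob μ s) ⟩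
      prob μ s                           ∎)
    col : ∀ r → prob ν r ≡ sumFin (λ s → prob μ s * prob ν r)
    col r = sym (begin
      sumFin (λ s → prob μ s * prob ν r) ≡⟨ sumFin-*ʳ (prob ν r) (prob μ) ⟩
      sumFin (prob μ) * prob ν r         ≡⟨ cong (_* prob ν r) (total μ) ⟩
      1ℚ * prob ν r                      ≡⟨ ℚ.*-identityˡ (prob ν r) ⟩
      prob ν r                           ∎)
    support : ∀ s r → 0ℚ < prob μ s * prob ν r → R s r
    support s r 0<μν = related s r
      (0<p*q⇒0<q (nonneg ν r) (subst (0ℚ <_) (ℚ.*-comm (prob μ s) (prob ν r)) 0<μν))
      (0<p*q⇒0<q (nonneg μ s) 0<μν)

  Lift⁺-δ : ∀ {μ r} → SupportRelated R μ r → Lift R μ (δ r)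
  Lift⁺-δ {μ} {r} related = Lift-product {μ} {δ r} λ s r′ 0<μs 0<δr′ →
    subst (R s) (spike-support {i = r} {r′} 0<δr′) (related s 0<μs)

  Lift⁻-δ : ∀ {μ r} → Lift R μ (δ r) → SupportRelated R μ r
  Lift⁻-δ {μ} {r} lift s 0<μs with Lift-support {μ} {δ r} lift s 0<μs
  ... | r′ , sRr′ , 0<δr′ = subst (R s) (sym (spike-support {i = r} {r′} 0<δr′)) sRr′

fromTransitions : ∀ {n} → Fin n → List (Trans n) → LPTS
fromTransitions {n} s₀ ts = record
  { states            = n
  ; start             = s₀
  ; alphabet          = map act ts
  ; trans             = ts
  ; trans-in-alphabet = λ _ → ∈-map⁺ act
  }

step? : ∀ L s a → Dec (∃[ μ ] (L ⊢ s ─[ a ]→ μ))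
step? L s a with any? (λ τ → (src τ Fin.≟ s) ×-dec (act τ ℕ.≟ a)) (trans L)
... | yes found = let τ , τ∈ , (src≡s , act≡a) = find found
                  in yes (dist τ , τ , τ∈ , src≡s , act≡a , refl)
... | no none   = no λ (_ , τ , τ∈ , src≡s , act≡a , _) → none (lose τ∈ (src≡s , act≡a))

record Split (x : ℚ) (A B : Set) : Set where
  field
    share       : ℚ
    0≤share     : 0ℚ ≤ share
    share≤x     : share ≤ x
    share-pos⇒A : 0ℚ < share → A
    rest-pos⇒B  : 0ℚ < x - share → B

split-by-label : ∀ {A B : Set} x → 0ℚ ≤ x → (0ℚ < x → A ⊎ B) → Split x A B
split-by-label x 0≤x label with 0ℚ ℚ.<? x
... | no 0≮x = record
  { share = 0ℚ ; 0≤share = ℚ.≤-refl ; share≤x = 0≤x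
  ; share-pos⇒A = λ 0<0 → contradiction 0<0 0≮0
  ; rest-pos⇒B  = λ 0<x-0 → contradiction (subst (0ℚ <_) (ℚ.+-identityʳ x) 0<x-0) 0≮x
  }
... | yes 0<x with label 0<x
...   | inj₁ a = record
  { share = x ; 0≤share = 0≤x ; share≤x = ℚ.≤-refl
  ; share-pos⇒A = const a
  ; rest-pos⇒B  = λ 0<x-x → contradiction (subst (0ℚ <_) (ℚ.+-inverseʳ x) 0<x-x) 0≮0
  }
...   | inj₂ b = record
  { share = 0ℚ ; 0≤share = ℚ.≤-refl ; share≤x = 0≤x
  ; share-pos⇒A = λ 0<0 → contradiction 0<0 0≮0
  ; rest-pos⇒B  = const b
  }

-- u₁ ≤ u is the part of u that must go left and u - u₁ the part that must go right;
-- v may go either way. Since Σu₁ ≤ ½, sending the fraction 1 - 2Σu₁ of v left and the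
-- rest right makes both sides weigh exactly ½.
module Rebalance {n} (u v u₁ : Fin n → ℚ)
  (0≤v : ∀ i → 0ℚ ≤ v i) (0≤u₁ : ∀ i → 0ℚ ≤ u₁ i) (u₁≤u : ∀ i → u₁ i ≤ u i)
  (∑u≡½ : sumFin u ≡ ½) (∑v≡½ : sumFin v ≡ ½) where

  β : ℚ
  β = sumFin u₁ + sumFin u₁

  w₁ w₂ : Fin n → ℚ
  w₁ i = u₁ i + (1ℚ - β) * v i
  w₂ i = (u i - u₁ i) + β * v i

  0≤β : 0ℚ ≤ β
  0≤β = ℚ.+-mono-≤ (sumFin-nonneg 0≤u₁) (sumFin-nonneg 0≤u₁)

  β≤1 : β ≤ 1ℚ
  β≤1 = ℚ.+-mono-≤ ∑u₁≤½ ∑u₁≤½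
    where
    ∑u₁≤½ : sumFin u₁ ≤ ½
    ∑u₁≤½ = subst (sumFin u₁ ≤_) ∑u≡½ (sumFin-mono u₁≤u)

  0≤w₁ : ∀ i → 0ℚ ≤ w₁ i
  0≤w₁ i = ℚ.+-mono-≤ (0≤u₁ i) (0≤p*q (0≤q-p β≤1) (0≤v i))

  0≤w₂ : ∀ i → 0ℚ ≤ w₂ i
  0≤w₂ i = ℚ.+-mono-≤ (0≤q-p (u₁≤u i)) (0≤p*q 0≤β (0≤v i))

  w₁+w₂≡u+v : ∀ i → w₁ i + w₂ i ≡ u i + v i
  w₁+w₂≡u+v i = regroup (u₁ i) (u i) (v i) β
    where
    open +-*-Solver
    regroup : ∀ x y z b → (x + (1ℚ - b) * z) + ((y - x) + b * z) ≡ y + z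
    regroup = solve 4
      (λ x y z b → (x :+ (con 1ℚ :- b) :* z) :+ ((y :- x) :+ b :* z) := y :+ z) refl

  ∑w₁≡½ : sumFin w₁ ≡ ½
  ∑w₁≡½ = begin
    sumFin w₁                                  ≡⟨ sumFin-+ u₁ (λ i → (1ℚ - β) * v i) ⟩
    sumFin u₁ + sumFin (λ i → (1ℚ - β) * v i)  ≡⟨ cong (sumFin u₁ +_) (sumFin-*ˡ (1ℚ - β) v) ⟩
    sumFin u₁ + (1ℚ - β) * sumFin v            ≡⟨ cong (λ s → sumFin u₁ + (1ℚ - β) * s) ∑v≡½ ⟩
    sumFin u₁ + (1ℚ - β) * ½                   ≡⟨ balance (sumFin u₁) ⟩
    ½                                          ∎
    where
    open +-*-Solver
    balance : ∀ m → m + (1ℚ - (m + m)) * ½ ≡ ½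
    balance = solve 1 (λ m → m :+ (con 1ℚ :- (m :+ m)) :* con ½ := con ½) refl

  ∑w₂≡½ : sumFin w₂ ≡ ½
  ∑w₂≡½ = ∙-cancelˡ ½ (sumFin w₂) ½ (begin
    ½ + sumFin w₂               ≡⟨ cong (_+ sumFin w₂) ∑w₁≡½ ⟨
    sumFin w₁ + sumFin w₂       ≡⟨ sumFin-+ w₁ w₂ ⟨
    sumFin (λ i → w₁ i + w₂ i)  ≡⟨ sumFin-cong w₁+w₂≡u+v ⟩
    sumFin (λ i → u i + v i)    ≡⟨ sumFin-+ u v ⟩
    sumFin u + sumFin v         ≡⟨ cong₂ _+_ ∑u≡½ ∑v≡½ ⟩
    ½ + ½                       ∎)
    where open GroupProperties ℚ.+-0-group using (∙-cancelˡ)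

  w₁-support : ∀ i → 0ℚ < w₁ i → 0ℚ < u₁ i ⊎ 0ℚ < v i
  w₁-support i 0<w₁ = map₂ (0<p*q⇒0<q (0≤q-p β≤1)) (0<p+q⇒ 0<w₁)

  w₂-support : ∀ i → 0ℚ < w₂ i → 0ℚ < u i - u₁ i ⊎ 0ℚ < v i
  w₂-support i 0<w₂ = map₂ (0<p*q⇒0<q 0≤β) (0<p+q⇒ 0<w₂)

pattern l-start  = zero
pattern l-choice = suc zero
pattern l-left   = suc (suc zero)
pattern l-right  = suc (suc (suc zero))
pattern l-dead   = suc (suc (suc (suc zero)))

pattern r-start = zero
pattern r-left  = suc zero
pattern r-right = suc (suc zero)

data _─L[_]→_ : Fin 5 → Action → Dist 5 → Set where
  start─1→       : l-start  ─L[ 1 ]→ coin l-choice l-dead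
  choice─0→left  : l-choice ─L[ 0 ]→ δ l-left
  choice─0→right : l-choice ─L[ 0 ]→ δ l-right
  left─2→        : l-left   ─L[ 2 ]→ δ l-left
  right─3→       : l-right  ─L[ 3 ]→ δ l-right

data _─R[_]→_ : Fin 3 → Action → Dist 3 → Set where
  start─1→ : r-start ─R[ 1 ]→ coin r-left r-right
  left─0→  : r-left  ─R[ 0 ]→ δ r-left
  left─2→  : r-left  ─R[ 2 ]→ δ r-left
  right─0→ : r-right ─R[ 0 ]→ δ r-right
  right─3→ : r-right ─R[ 3 ]→ δ r-right

L : LPTS
L = fromTransitions {5} l-start
  ( ⟨ l-start  , 1 , coin l-choice l-dead ⟩
  ∷ ⟨ l-choice , 0 , δ l-left ⟩
  ∷ ⟨ l-choice , 0 , δ l-right ⟩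
  ∷ ⟨ l-left   , 2 , δ l-left ⟩
  ∷ ⟨ l-right  , 3 , δ l-right ⟩
  ∷ [])

R : LPTS
R = fromTransitions {3} r-start
  ( ⟨ r-start , 1 , coin r-left r-right ⟩
  ∷ ⟨ r-left  , 0 , δ r-left ⟩
  ∷ ⟨ r-left  , 2 , δ r-left ⟩
  ∷ ⟨ r-right , 0 , δ r-right ⟩
  ∷ ⟨ r-right , 3 , δ r-right ⟩
  ∷ [])

L-step : ∀ {s a μ} → s ─L[ a ]→ μ → L ⊢ s ─[ a ]→ μ
L-step start─1→       = _ , here refl , refl , refl , refl
L-step choice─0→left  = _ , there (here refl) , refl , refl , refl
L-step choice─0→right = _ , there (there (here refl)) , refl , refl , refl
L-step left─2→        = _ , there (there (there (here refl))) , refl , refl , refl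
L-step right─3→       = _ , there (there (there (there (here refl)))) , refl , refl , refl

L-step⁻ : ∀ {s a μ} → L ⊢ s ─[ a ]→ μ → s ─L[ a ]→ μ
L-step⁻ (_ , here refl , refl , refl , refl)                                 = start─1→
L-step⁻ (_ , there (here refl) , refl , refl , refl)                         = choice─0→left
L-step⁻ (_ , there (there (here refl)) , refl , refl , refl)                 = choice─0→right
L-step⁻ (_ , there (there (there (here refl))) , refl , refl , refl)         = left─2→
L-step⁻ (_ , there (there (there (there (here refl)))) , refl , refl , refl) = right─3→

R-step : ∀ {s a μ} → s ─R[ a ]→ μ → R ⊢ s ─[ a ]→ μ
R-step start─1→ = _ , here refl , refl , refl , refl
R-step left─0→  = _ , there (here refl) , refl , refl , refl
R-step left─2→  = _ , there (there (here refl)) , refl , refl , refl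
R-step right─0→ = _ , there (there (there (here refl))) , refl , refl , refl
R-step right─3→ = _ , there (there (there (there (here refl)))) , refl , refl , refl

R-step⁻ : ∀ {s a μ} → R ⊢ s ─[ a ]→ μ → s ─R[ a ]→ μ
R-step⁻ (_ , here refl , refl , refl , refl)                                 = start─1→
R-step⁻ (_ , there (here refl) , refl , refl , refl)                         = left─0→
R-step⁻ (_ , there (there (here refl)) , refl , refl , refl)                 = left─2→
R-step⁻ (_ , there (there (there (here refl))) , refl , refl , refl)         = right─0→
R-step⁻ (_ , there (there (there (there (here refl)))) , refl , refl , refl) = right─3→

─R→-deterministic : ∀ {s a μ ν} → s ─R[ a ]→ μ → s ─R[ a ]→ ν → μ ≡ ν
─R→-deterministic start─1→ start─1→ = refl
─R→-deterministic left─0→  left─0→  = refl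
─R→-deterministic left─2→  left─2→  = refl
─R→-deterministic right─0→ right─0→ = refl
─R→-deterministic right─3→ right─3→ = refl

R-reactive : Reactive R
R-reactive s a μ ν s─a→μ s─a→ν i =
  cong (λ ρ → prob ρ i) (─R→-deterministic (R-step⁻ s─a→μ) (R-step⁻ s─a→ν))

left-loop : ∀ {a} → a ≡ 0 ⊎ a ≡ 2 → R ⊢ r-left ─[ a ]→ δ r-left
left-loop (inj₁ refl) = R-step left─0→
left-loop (inj₂ refl) = R-step left─2→

right-loop : ∀ {a} → a ≡ 0 ⊎ a ≡ 3 → R ⊢ r-right ─[ a ]→ δ r-right
right-loop (inj₁ refl) = R-step right─0→
right-loop (inj₂ refl) = R-step right─3→

module _ {Sim : Fin 5 → Fin 3 → Set} (sim : StrongSimulation L R Sim) where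

  answer-in-R : ∀ {s₁ s₂ a μ} → Sim s₁ s₂ → s₁ ─L[ a ]→ μ →
                ∃[ ν ] (s₂ ─R[ a ]→ ν × Lift Sim μ ν)
  answer-in-R related move with sim _ _ related _ _ (L-step move)
  ... | ν , move′ , lift = ν , R-step⁻ move′ , lift

  right≁left : ¬ Sim l-right r-left
  right≁left related with answer-in-R related right─3→
  ... | _ , () , _

  choice≁left : ¬ Sim l-choice r-left
  choice≁left related with answer-in-R related choice─0→right
  ... | _ , left─0→ , lift =
    right≁left (Lift⁻-δ {μ = δ l-right} {r = r-left} lift l-right (ℚ.positive⁻¹ 1ℚ))

  left≁right : ¬ Sim l-left r-right
  left≁right related with answer-in-R related left─2→
  ... | _ , () , _

  choice≁right : ¬ Sim l-choice r-right
  choice≁right related with answer-in-R related choice─0→left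
  ... | _ , right─0→ , lift =
    left≁right (Lift⁻-δ {μ = δ l-left} {r = r-right} lift l-left (ℚ.positive⁻¹ 1ℚ))

  choice-unmatched : ¬ (∃[ r ] (Sim l-choice r × 0ℚ < prob (coin r-left r-right) r))
  choice-unmatched (r-start , _       , 0<0) = 0≮0 0<0
  choice-unmatched (r-left  , related , _)   = choice≁left related
  choice-unmatched (r-right , related , _)   = choice≁right related

L⋠R : ¬ (L ≼ R)
L⋠R (Sim , sim , start-related) with answer-in-R sim start-related start─1→
... | _ , start─1→ , lift = choice-unmatched sim
  (Lift-support {μ = coin l-choice l-dead} {coin r-left r-right} lift l-choice (ℚ.positive⁻¹ ½))

module FromSimulation (C : LPTS) (C-reactive : Reactive C)
                      {Sim : State C → Fin 5 → Set} (sim : StrongSimulation C L Sim) where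

  answer-in-L : ∀ {c l a μ} → Sim c l → C ⊢ c ─[ a ]→ μ →
                ∃[ ν ] (l ─L[ a ]→ ν × Lift Sim μ ν)
  answer-in-L related move with sim _ _ related _ _ move
  ... | ν , move′ , lift = ν , L-step⁻ move′ , lift

  Committed : Fin 5 → Action → State C → Set
  Committed l k c = ∀ a μ → C ⊢ c ─[ a ]→ μ → (a ≡ 0 ⊎ a ≡ k) × SupportRelated Sim μ l

  left-committed : ∀ {c} → Sim c l-left → Committed l-left 2 c
  left-committed related a μ move with answer-in-L related move
  ... | _ , left─2→ , lift = inj₂ refl , Lift⁻-δ {μ = μ} {r = l-left} lift

  right-committed : ∀ {c} → Sim c l-right → Committed l-right 3 c
  right-committed related a μ move with answer-in-L related move
  ... | _ , right─3→ , lift = inj₂ refl , Lift⁻-δ {μ = μ} {r = l-right} lift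

  dead-committed : ∀ {c l k} → Sim c l-dead → Committed l k c
  dead-committed related a μ move with answer-in-L related move
  ... | _ , () , _

  choice-moves-on-0 : ∀ {c a μ} → Sim c l-choice → C ⊢ c ─[ a ]→ μ → a ≡ 0
  choice-moves-on-0 related move with answer-in-L related move
  ... | _ , choice─0→left  , _ = refl
  ... | _ , choice─0→right , _ = refl

  committed-by-0-move : ∀ {c ν l k} → Sim c l-choice → C ⊢ c ─[ 0 ]→ ν →
                        SupportRelated Sim ν l → Committed l k c
  committed-by-0-move related ν-move ν-related a μ move with choice-moves-on-0 related move
  ... | refl = inj₁ refl ,
    λ s 0<μs → ν-related s (subst (0ℚ <_) (C-reactive _ 0 μ _ move ν-move s) 0<μs)

  choice-committed : ∀ {c} → Sim c l-choice → Committed l-left 2 c ⊎ Committed l-right 3 c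
  choice-committed {c} related with step? C c 0
  ... | no no-0-move = inj₁ λ a μ move →
    contradiction (μ , subst (λ b → C ⊢ c ─[ b ]→ μ) (choice-moves-on-0 related move) move) no-0-move
  ... | yes (ν , ν-move) with answer-in-L related ν-move
  ...   | _ , choice─0→left  , lift =
    inj₁ (committed-by-0-move related ν-move (Lift⁻-δ {μ = ν} {r = l-left} lift))
  ...   | _ , choice─0→right , lift =
    inj₂ (committed-by-0-move related ν-move (Lift⁻-δ {μ = ν} {r = l-right} lift))

  SimR : State C → Fin 3 → Set
  SimR c r-start = Sim c l-start
  SimR c r-left  = Committed l-left 2 c
  SimR c r-right = Committed l-right 3 c

  start-lift : ∀ {μ} → Lift Sim μ (coin l-choice l-dead) → Lift SimR μ (coin r-left r-right)
  start-lift {μ} (w , bounds , row , col , related) =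
    Lift-fromCoupling {μ₁ = μ} {coin r-left r-right} W 0≤W row′ col′ support
    where
    0≤w : ∀ c l → 0ℚ ≤ w c l
    0≤w c l = proj₁ (bounds c l)

    u v : State C → ℚ
    u c = w c l-choice
    v c = w c l-dead

    unused : ∀ l → prob (coin l-choice l-dead) l ≡ 0ℚ → ∀ c → w c l ≡ 0ℚ
    unused l ≡0 = sumFin≡0⇒≡0 (λ c → 0≤w c l) (≡-trans (sym (col l)) ≡0)

    mass-split : ∀ c → prob μ c ≡ u c + v c
    mass-split c = begin
      prob μ c                                                  ≡⟨ row c ⟩
      w c l-start + (u c + (w c l-left + (w c l-right + (v c + 0ℚ))))
        ≡⟨ cong₂ (λ a b → a + (u c + b)) (unused l-start refl c)
                 (cong₂ (λ a b → a + (b + (v c + 0ℚ))) (unused l-left refl c) (unused l-right refl c)) ⟩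
      0ℚ + (u c + (0ℚ + (0ℚ + (v c + 0ℚ))))                     ≡⟨ drop-zeros (u c) (v c) ⟩
      u c + v c                                                 ∎
      where
      open +-*-Solver
      drop-zeros : ∀ x y → 0ℚ + (x + (0ℚ + (0ℚ + (y + 0ℚ)))) ≡ x + y
      drop-zeros = solve 2
        (λ x y → con 0ℚ :+ (x :+ (con 0ℚ :+ (con 0ℚ :+ (y :+ con 0ℚ)))) := x :+ y) refl

    split : ∀ c → Split (u c) (Committed l-left 2 c) (Committed l-right 3 c)
    split c = split-by-label (u c) (0≤w c l-choice)
                λ 0<u → choice-committed (related c l-choice 0<u)

    open Rebalance u v (λ c → Split.share (split c)) (λ c → 0≤w c l-dead)
      (λ c → Split.0≤share (split c)) (λ c → Split.share≤x (split c))
      (sym (col l-choice)) (sym (col l-dead))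

    W : State C → Fin 3 → ℚ
    W c r-start = 0ℚ
    W c r-left  = w₁ c
    W c r-right = w₂ c

    0≤W : ∀ c r → 0ℚ ≤ W c r
    0≤W c r-start = ℚ.≤-refl
    0≤W c r-left  = 0≤w₁ c
    0≤W c r-right = 0≤w₂ c

    row′ : ∀ c → prob μ c ≡ sumFin (W c)
    row′ c = begin
      prob μ c                   ≡⟨ mass-split c ⟩
      u c + v c                  ≡⟨ w₁+w₂≡u+v c ⟨
      w₁ c + w₂ c                ≡⟨ cong (w₁ c +_) (ℚ.+-identityʳ (w₂ c)) ⟨
      w₁ c + (w₂ c + 0ℚ)         ≡⟨ ℚ.+-identityˡ _ ⟨
      0ℚ + (w₁ c + (w₂ c + 0ℚ))  ∎

    col′ : ∀ r → prob (coin r-left r-right) r ≡ sumFin (λ c → W c r)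
    col′ r-start = sym (sumFin-zero (states C))
    col′ r-left  = sym ∑w₁≡½
    col′ r-right = sym ∑w₂≡½

    support : ∀ c r → 0ℚ < W c r → SimR c r
    support c r-start 0<0 = contradiction 0<0 0≮0
    support c r-left  0<w₁ = [ Split.share-pos⇒A (split c) , dead ]′ (w₁-support c 0<w₁)
      where dead = λ 0<v → dead-committed (related c l-dead 0<v)
    support c r-right 0<w₂ = [ Split.rest-pos⇒B (split c) , dead ]′ (w₂-support c 0<w₂)
      where dead = λ 0<v → dead-committed (related c l-dead 0<v)

  simR : StrongSimulation C R SimR
  simR c r-start related a μ move with answer-in-L related move
  ... | _ , start─1→ , lift = coin r-left r-right , R-step start─1→ , start-lift {μ} lift
  simR c r-left committed a μ move =
    δ r-left , left-loop (proj₁ (committed a μ move)) ,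
    Lift⁺-δ {μ = μ} {r = r-left} λ s 0<μs → left-committed (proj₂ (committed a μ move) s 0<μs)
  simR c r-right committed a μ move =
    δ r-right , right-loop (proj₁ (committed a μ move)) ,
    Lift⁺-δ {μ = μ} {r = r-right} λ s 0<μs → right-committed (proj₂ (committed a μ move) s 0<μs)

reactive-≼L⇒≼R : ∀ C → Reactive C → C ≼ L → C ≼ R
reactive-≼L⇒≼R C C-reactive (Sim , sim , start-related) = SimR , simR , start-related
  where open FromSimulation C C-reactive sim

lemma5 : Σ LPTS λ L → Σ LPTS λ R →
           Reactive R × ¬ (L ≼ R) ×
           ¬ (Σ LPTS λ C → Reactive C × (C ≼ L) × ¬ (C ≼ R))
lemma5 = L , R , R-reactive , L⋠R ,
  λ (C , C-reactive , C≼L , C⋠R) → C⋠R (reactive-≼L⇒≼R C C-reactive C≼L)
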